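{- Let $p$ be a prime and $1\le k\le\nu$ integers, and let $\Omega_p^{k,\nu}:=\ker\big((\mathbb{Z}/p^\nu\mathbb{Z})^\times\to(\mathbb{Z}/p^k\mathbb{Z})^\times\big)=\{1+\beta p^k\mid\beta\in\mathbb{Z}/p^\nu\mathbb{Z}\}$, acting on $\mathbb{Z}/p^\nu\mathbb{Z}$ by multiplication. Assume that $p$ is odd, or that $p=2$ and $k\ge 2$. Then $$H^1(\Omega_p^{k,\nu},\mathbb{Z}/p^\nu\mathbb{Z})=0=H^2(\Omega_p^{k,\nu},\mathbb{Z}/p^\nu\mathbb{Z}).$$ -}

module Defs where

open import Data.Nat as ℕ using (ℕ; NonZero; _^_; nonTrivial⇒nonZero)
open import Data.Nat.Properties using (m^n≢0)
open import Data.Nat.DivMod using (_mod_)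
open import Data.Nat.Primality using (Prime; prime)
open import Data.Fin using (Fin; toℕ)
open import Data.Integer using (ℤ; +_; _+_; _-_; _*_)
open import Data.Integer.Divisibility using (_∣_)
open import Data.Product using (∃; Σ)
open import Relation.Binary.PropositionalEquality using (_≡_)

-- Z/p^ν is represented by Fin (p ^ ν) for the group Ω (a subset of (Z/p^ν)^×),
-- and the coefficient module Z/p^ν is represented by integer representatives
-- taken up to congruence modulo p^ν.
module _ (p k ν : ℕ) (pp : Prime p) where

  N : ℕ
  N = p ^ ν

  private
    pnz : Prime p → NonZero p
    pnz (prime _) = nonTrivial⇒nonZero p
    instance
      p≢0 : NonZero p
      p≢0 = pnz pp
      N≢0 : NonZero N
      N≢0 = m^n≢0 p ν

  Res : Set
  Res = Fin N

  InΩ : Res → Set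
  InΩ g = ∃ λ (β : ℕ) → toℕ g ≡ ℕ.suc (β ℕ.* p ^ k)

  _·_ : Res → Res → Res
  g · h = (toℕ g ℕ.* toℕ h) mod N

  act : Res → ℤ → ℤ
  act g a = (+ toℕ g) * a

  _≈_ : ℤ → ℤ → Set
  a ≈ b = (+ N) ∣ (a - b)

  -- inhomogeneous 1-cochains / 2-cochains Ω → Z/p^ν, Ω × Ω → Z/p^ν
  -- (given as functions on all residues; only values on Ω matter)
  IsCocycle1 : (Res → ℤ) → Set
  IsCocycle1 f = ∀ g h → InΩ g → InΩ h → f (g · h) ≈ (f g + act g (f h))

  IsCoboundary1 : (Res → ℤ) → Set
  IsCoboundary1 f = Σ ℤ λ a → ∀ g → InΩ g → f g ≈ (act g a - a)

  H1Vanishes : Set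
  H1Vanishes = ∀ (f : Res → ℤ) → IsCocycle1 f → IsCoboundary1 f

  IsCocycle2 : (Res → Res → ℤ) → Set
  IsCocycle2 f = ∀ g h l → InΩ g → InΩ h → InΩ l →
    (act g (f h l) - f (g · h) l + f g (h · l) - f g h) ≈ (+ 0)

  IsCoboundary2 : (Res → Res → ℤ) → Set
  IsCoboundary2 f = Σ (Res → ℤ) λ c → ∀ g h → InΩ g → InΩ h →
    f g h ≈ (act g (c h) - c (g · h) + c g)

  H2Vanishes : Set
  H2Vanishes = ∀ (f : Res → Res → ℤ) → IsCocycle2 f → IsCoboundary2 f

module Submission where

-- Ω is cyclic of order n = p^(ν−k), generated by u = 1 + p^k: lifting the exponent gives
-- u^(p^m) = 1 + p^(k+m)(1 + p z), so the powers u^i (i < n) are distinct modulo p^ν, and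
-- they exhaust the n residues 1 + β p^k. Pulling cochains back along i ↦ u^i to the monoid ℕ,
-- where every cocycle is explicitly a coboundary, the only obstruction to descending back to
-- Ω lies in the Tate groups ker N / (u − 1)M and M^u / N M, with N = 1 + u + ⋯ + u^(n−1).
-- Here u − 1 = p^k and N = n (1 + p z) with 1 + p z a unit, while p^k n = p^ν, so both vanish.

open import Defs hiding (_≈_)
open import Data.Nat using (ℕ; _≤_; _%_)
open import Data.Nat.Primality using (Prime)
open import Data.Product using (_×_)
open import Data.Sum using (_⊎_)
open import Relation.Binary.PropositionalEquality using (_≡_)

open import Level using (0ℓ)
open import Data.Integer using (ℤ)
open import Data.Nat as ℕ using (zero; suc; NonZero)
import Data.Nat.Properties as ℕₚ
import Data.Sum
open import Data.Nat.DivMod using (_/_; m≡m%n+[m/n]*n)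
open import Data.Product using (∃; _,_; proj₁; proj₂)
open import Relation.Binary.PropositionalEquality
  using (refl; sym; trans; cong; cong₂; subst; subst₂; module ≡-Reasoning)
open import Relation.Binary.Bundles using (Setoid)
import Relation.Binary.Reasoning.Setoid as SetoidReasoning

module Periodic {c ℓ} (S : Setoid c ℓ) (n : ℕ) (f : ℕ → Setoid.Carrier S)
                (f-periodic : ∀ i → Setoid._≈_ S (f (i ℕ.+ n)) (f i)) where
  open Setoid S using (_≈_; reflexive)
  open SetoidReasoning S

  periodic-multiple : ∀ r q → f (r ℕ.+ q ℕ.* n) ≈ f r
  periodic-multiple r zero = reflexive (cong f (ℕₚ.+-identityʳ r))
  periodic-multiple r (suc q) = begin
    f (r ℕ.+ (n ℕ.+ q ℕ.* n)) ≡⟨ cong (λ i → f (r ℕ.+ i)) (ℕₚ.+-comm n (q ℕ.* n)) ⟩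
    f (r ℕ.+ (q ℕ.* n ℕ.+ n)) ≡⟨ cong f (ℕₚ.+-assoc r (q ℕ.* n) n) ⟨
    f (r ℕ.+ q ℕ.* n ℕ.+ n)   ≈⟨ f-periodic (r ℕ.+ q ℕ.* n) ⟩
    f (r ℕ.+ q ℕ.* n)         ≈⟨ periodic-multiple r q ⟩
    f r                       ∎

  periodic-mod : .{{_ : NonZero n}} → ∀ i → f (i % n) ≈ f i
  periodic-mod i = begin
    f (i % n)                   ≈⟨ periodic-multiple (i % n) (i / n) ⟨
    f (i % n ℕ.+ (i / n) ℕ.* n) ≡⟨ cong f (sym (m≡m%n+[m/n]*n i n)) ⟩
    f i                         ∎

module Binomial where
  open import Data.Nat using (zero; suc; _+_; _*_; _^_)
  open import Relation.Binary.PropositionalEquality using (refl; trans; cong)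
  open import Data.Nat.Tactic.RingSolver using (solve-∀)

  triangle : ℕ → ℕ
  triangle zero = 0
  triangle (suc r) = triangle r + r

  triangle-odd : ∀ q → triangle (suc (q * 2)) ≡ suc (q * 2) * q
  triangle-odd zero = refl
  triangle-odd (suc q) = trans (cong (λ t → t + suc (q * 2) + suc (suc (q * 2))) (triangle-odd q)) (step q)
    where
    step : ∀ q → suc (q * 2) * q + suc (q * 2) + suc (suc (q * 2)) ≡ suc (suc (suc (q * 2))) * suc q
    step = solve-∀

  cubicRest : ℕ → ℕ → ℕ
  cubicRest a zero = 0
  cubicRest a (suc r) = cubicRest a r + triangle r + a * cubicRest a r

  binomial-cubic : ∀ a r → (1 + a) ^ r ≡ 1 + r * a + triangle r * (a * a) + a * a * a * cubicRest a r
  binomial-cubic a zero = base a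
    where
    base : ∀ a → 1 ≡ 1 + 0 * a + 0 * (a * a) + a * a * a * 0
    base = solve-∀
  binomial-cubic a (suc r) = trans (cong ((1 + a) *_) (binomial-cubic a r)) (step a r (triangle r) (cubicRest a r))
    where
    step : ∀ a r t y → (1 + a) * (1 + r * a + t * (a * a) + a * a * a * y)
                     ≡ 1 + (1 + r) * a + (t + r) * (a * a) + a * a * a * (y + t + a * y)
    step = solve-∀

  binomial-linear : ∀ q w r → ∃ λ z → (1 + q * w) ^ r ≡ 1 + q * (r * w + q * z)
  binomial-linear q w r =
    w * w * (triangle r + q * w * cubicRest (q * w) r) ,
    trans (binomial-cubic (q * w) r) (regroup q w r (triangle r) (cubicRest (q * w) r))
    where
    regroup : ∀ q w r t y → 1 + r * (q * w) + t * (q * w * (q * w)) + q * w * (q * w) * (q * w) * y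
                          ≡ 1 + q * (r * w + q * (w * w * (t + q * w * y)))
    regroup = solve-∀

module Remainders where
  open import Data.Nat using (zero; suc; _+_; _*_; _<_; NonZero)
  open import Data.Nat.Properties using (+-cancelˡ-≡; +-assoc; <-irrefl; <-≤-trans)
  open import Data.Nat.Divisibility using (_∣_; ∣m+n∣m⇒∣n; n∣m*n; ∣⇒≤)
  open import Data.Nat.DivMod using (_/_; m≡m%n+[m/n]*n; [m+kn]%n≡m%n; m<n⇒m%n≡m)
  open import Data.Empty using (⊥-elim)
  open import Relation.Binary.PropositionalEquality using (refl; sym; trans; cong; subst)

  [m+n]%o≡m%o⇒o∣n : ∀ m n o .{{_ : NonZero o}} → (m + n) % o ≡ m % o → o ∣ n
  [m+n]%o≡m%o⇒o∣n m n o same = ∣m+n∣m⇒∣n (subst (o ∣_) (sym quotients) (n∣m*n ((m + n) / o))) (n∣m*n (m / o))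
    where
    quotients : m / o * o + n ≡ (m + n) / o * o
    quotients = +-cancelˡ-≡ (m % o) _ _ (begin
      m % o + (m / o * o + n)       ≡⟨ +-assoc (m % o) (m / o * o) n ⟨
      m % o + m / o * o + n         ≡⟨ cong (_+ n) (m≡m%n+[m/n]*n m o) ⟨
      m + n                         ≡⟨ m≡m%n+[m/n]*n (m + n) o ⟩
      (m + n) % o + (m + n) / o * o ≡⟨ cong (_+ (m + n) / o * o) same ⟩
      m % o + (m + n) / o * o       ∎)
      where open ≡-Reasoning

  m%n≡1⇒m≡1+[m/n]*n : ∀ m n .{{_ : NonZero n}} → m % n ≡ 1 → m ≡ 1 + m / n * n
  m%n≡1⇒m≡1+[m/n]*n m n m%n≡1 = trans (m≡m%n+[m/n]*n m n) (cong (_+ m / n * n) m%n≡1)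

  [1+kn]%n≡1 : ∀ k n .{{_ : NonZero n}} → 1 < n → (1 + k * n) % n ≡ 1
  [1+kn]%n≡1 k n 1<n = trans ([m+kn]%n≡m%n 1 k n) (m<n⇒m%n≡m 1<n)

  n∣m∧m<n⇒m≡0 : ∀ {m n} → n ∣ m → m < n → m ≡ 0
  n∣m∧m<n⇒m≡0 {zero} _ _ = refl
  n∣m∧m<n⇒m≡0 {suc m} n∣m m<n = ⊥-elim (<-irrefl refl (<-≤-trans m<n (∣⇒≤ n∣m)))

module _ where
  open import Data.Fin using (Fin; punchOut)
  open import Data.Fin.Properties using (any?; _≟_; pigeonhole; punchOut-injective; <⇒≢)
  open import Relation.Nullary using (yes; no)
  open import Data.Empty using (⊥; ⊥-elim)

  injective⇒surjective : ∀ {m} (f : Fin m → Fin m) → (∀ {i j} → f i ≡ f j → i ≡ j) → ∀ y → ∃ λ x → f x ≡ y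
  injective⇒surjective {suc m} f f-injective y with any? (λ x → f x ≟ y)
  ... | yes hit = hit
  ... | no miss = ⊥-elim collision
    where
    f≢y : ∀ x → y ≡ f x → ⊥
    f≢y x y≡fx = miss (x , sym y≡fx)
    collision : ⊥
    collision with pigeonhole (ℕₚ.n<1+n m) (λ x → punchOut (f≢y x))
    ... | i , j , i<j , same = <⇒≢ i<j (f-injective (punchOut-injective (f≢y i) (f≢y j) same))

module Congruence (m : ℕ) where
  open import Data.Integer using (ℤ; +_; 0ℤ; -_; _+_; _-_; _*_)
  open import Data.Integer.Properties using (+-inverseʳ; +-minus-telescope; +-identityʳ; pos-+; pos-*)
  import Data.Integer.Divisibility as Unsigned
  open import Data.Integer.Divisibility.Signed
    using (_∣_; divides; ∣ᵤ⇒∣; ∣⇒∣ᵤ; ∣m∣n⇒∣m+n; ∣m⇒∣-m; ∣m⇒∣m*n; ∣n⇒∣m*n)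
  import Data.Integer.Tactic.RingSolver as ℤ-Solver

  -- A record rather than Defs' unsigned divisibility, so that both sides are inferable
  -- (fromUnsigned and toUnsigned convert).
  infix 4 _≈_
  record _≈_ (a b : ℤ) : Set where
    constructor ∣⇒≈
    field ≈⇒∣ : + m ∣ a - b
  open _≈_ public

  fromUnsigned : ∀ {a b} → + m Unsigned.∣ a - b → a ≈ b
  fromUnsigned m∣a-b = ∣⇒≈ (∣ᵤ⇒∣ m∣a-b)

  toUnsigned : ∀ {a b} → a ≈ b → + m Unsigned.∣ a - b
  toUnsigned a≈b = ∣⇒∣ᵤ (≈⇒∣ a≈b)

  ≈-reflexive : ∀ {a b} → a ≡ b → a ≈ b
  ≈-reflexive {a} refl = ∣⇒≈ (divides 0ℤ (+-inverseʳ a))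

  ≈-refl : ∀ {a} → a ≈ a
  ≈-refl = ≈-reflexive refl

  private
    rearranged : ∀ {d e} → d ≡ e → + m ∣ d → + m ∣ e
    rearranged = subst (+ m ∣_)

  ≈-sym : ∀ {a b} → a ≈ b → b ≈ a
  ≈-sym {a} {b} (∣⇒≈ m∣a-b) = ∣⇒≈ (rearranged (swap a b) (∣m⇒∣-m m∣a-b))
    where
    swap : ∀ a b → - (a - b) ≡ b - a
    swap = ℤ-Solver.solve-∀

  ≈-trans : ∀ {a b c} → a ≈ b → b ≈ c → a ≈ c
  ≈-trans {a} {b} {c} (∣⇒≈ m∣a-b) (∣⇒≈ m∣b-c) =
    ∣⇒≈ (rearranged (+-minus-telescope a b c) (∣m∣n⇒∣m+n m∣a-b m∣b-c))

  setoid : Setoid 0ℓ 0ℓ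
  setoid = record
    { Carrier = ℤ
    ; _≈_ = _≈_
    ; isEquivalence = record { refl = ≈-refl ; sym = ≈-sym ; trans = ≈-trans }
    }

  +-cong : ∀ {a b c d} → a ≈ b → c ≈ d → a + c ≈ b + d
  +-cong {a} {b} {c} {d} (∣⇒≈ m∣a-b) (∣⇒≈ m∣c-d) =
    ∣⇒≈ (rearranged (regroup a b c d) (∣m∣n⇒∣m+n m∣a-b m∣c-d))
    where
    regroup : ∀ a b c d → (a - b) + (c - d) ≡ (a + c) - (b + d)
    regroup = ℤ-Solver.solve-∀

  -‿cong : ∀ {a b} → a ≈ b → - a ≈ - b
  -‿cong {a} {b} (∣⇒≈ m∣a-b) = ∣⇒≈ (rearranged (regroup a b) (∣m⇒∣-m m∣a-b))
    where
    regroup : ∀ a b → - (a - b) ≡ - a - - b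
    regroup = ℤ-Solver.solve-∀

  -cong : ∀ {a b c d} → a ≈ b → c ≈ d → a - c ≈ b - d
  -cong a≈b c≈d = +-cong a≈b (-‿cong c≈d)

  *-cong : ∀ {a b c d} → a ≈ b → c ≈ d → a * c ≈ b * d
  *-cong {a} {b} {c} {d} (∣⇒≈ m∣a-b) (∣⇒≈ m∣c-d) =
    ∣⇒≈ (rearranged (regroup a b c d) (∣m∣n⇒∣m+n (∣m⇒∣m*n c m∣a-b) (∣n⇒∣m*n b m∣c-d)))
    where
    regroup : ∀ a b c d → (a - b) * c + b * (c - d) ≡ a * c - b * d
    regroup = ℤ-Solver.solve-∀

  +-congˡ : ∀ a {b c} → b ≈ c → a + b ≈ a + c
  +-congˡ a = +-cong (≈-refl {a})

  +-congʳ : ∀ c {a b} → a ≈ b → a + c ≈ b + c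
  +-congʳ c a≈b = +-cong a≈b (≈-refl {c})

  -congˡ : ∀ a {b c} → b ≈ c → a - b ≈ a - c
  -congˡ a b≈c = -cong (≈-refl {a}) b≈c

  -congʳ : ∀ c {a b} → a ≈ b → a - c ≈ b - c
  -congʳ c a≈b = -cong a≈b (≈-refl {c})

  *-congˡ : ∀ a {b c} → b ≈ c → a * b ≈ a * c
  *-congˡ a = *-cong (≈-refl {a})

  ≈⇒-≈0 : ∀ {a b} → a ≈ b → a - b ≈ 0ℤ
  ≈⇒-≈0 {a} {b} a≈b = ≈-trans (-cong a≈b (≈-refl {b})) (≈-reflexive (+-inverseʳ b))

  %-≈ : ∀ x .{{_ : NonZero m}} → + (x % m) ≈ + x
  %-≈ x = ∣⇒≈ (divides (- + (x / m)) (begin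
    + (x % m) - + x                             ≡⟨ cong (λ y → + (x % m) - + y) (m≡m%n+[m/n]*n x m) ⟩
    + (x % m) - + (x % m ℕ.+ x / m ℕ.* m)       ≡⟨ cong (λ y → + (x % m) - y) (pos-+ (x % m) (x / m ℕ.* m)) ⟩
    + (x % m) - (+ (x % m) + + (x / m ℕ.* m))   ≡⟨ cong (λ y → + (x % m) - (+ (x % m) + y)) (pos-* (x / m) m) ⟩
    + (x % m) - (+ (x % m) + + (x / m) * + m)   ≡⟨ cancel (+ (x % m)) (+ (x / m)) (+ m) ⟩
    - + (x / m) * + m                           ∎))
    where
    open ≡-Reasoning
    cancel : ∀ r q m → r - (r + q * m) ≡ - q * m
    cancel = ℤ-Solver.solve-∀

  multiple≈0 : ∀ q → q * + m ≈ 0ℤ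
  multiple≈0 q = ∣⇒≈ (divides q (+-identityʳ (q * + m)))

  ≈0⇒∣ : ∀ {a} → a ≈ 0ℤ → + m ∣ a
  ≈0⇒∣ {a} (∣⇒≈ m∣a-0) = rearranged (+-identityʳ a) m∣a-0

module Powers where
  open import Data.Integer using (ℤ; +_; 0ℤ; 1ℤ; -_; _+_; _-_; _*_; _^_)
  open import Data.Integer.Properties using (^-distribˡ-+-*)
  import Data.Integer.Properties as ℤₚ
  import Data.Integer.Tactic.RingSolver as ℤ-Solver
  open ≡-Reasoning

  geom : ℤ → ℕ → ℤ
  geom U zero = 0ℤ
  geom U (suc i) = geom U i + U ^ i

  geom-telescope : ∀ U i → (U - 1ℤ) * geom U i ≡ U ^ i - 1ℤ
  geom-telescope U zero = base U
    where
    base : ∀ U → (U - 1ℤ) * 0ℤ ≡ 1ℤ - 1ℤ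
    base = ℤ-Solver.solve-∀
  geom-telescope U (suc i) = begin
    (U - 1ℤ) * (geom U i + U ^ i)         ≡⟨ distrib U (geom U i) (U ^ i) ⟩
    (U - 1ℤ) * geom U i + (U - 1ℤ) * U ^ i ≡⟨ cong (_+ (U - 1ℤ) * U ^ i) (geom-telescope U i) ⟩
    U ^ i - 1ℤ + (U - 1ℤ) * U ^ i          ≡⟨ collect U (U ^ i) ⟩
    U * U ^ i - 1ℤ                         ∎
    where
    distrib : ∀ U s v → (U - 1ℤ) * (s + v) ≡ (U - 1ℤ) * s + (U - 1ℤ) * v
    distrib = ℤ-Solver.solve-∀
    collect : ∀ U v → v - 1ℤ + (U - 1ℤ) * v ≡ U * v - 1ℤ
    collect = ℤ-Solver.solve-∀

  pos-^ : ∀ (a i : ℕ) → + (a ℕ.^ i) ≡ (+ a) ^ i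
  pos-^ a zero = refl
  pos-^ a (suc i) = trans (ℤₚ.pos-* a (a ℕ.^ i)) (cong (+ a *_) (pos-^ a i))

  -- The inverse is the truncated geometric series w = Σ_{i<k} (−a z)^i.
  1+az-invertible : ∀ a z k → ∃ λ w → ∃ λ r → (1ℤ + a * z) * w ≡ 1ℤ + a ^ k * r
  1+az-invertible a z zero = 0ℤ , - 1ℤ , base a z
    where
    base : ∀ a z → (1ℤ + a * z) * 0ℤ ≡ 1ℤ + 1ℤ * - 1ℤ
    base = ℤ-Solver.solve-∀
  1+az-invertible a z (suc k) with 1+az-invertible a z k
  ... | w , r , eq = w - a ^ k * r , - (z * r) , (begin
    (1ℤ + a * z) * (w - a ^ k * r)                 ≡⟨ distrib (1ℤ + a * z) w (a ^ k * r) ⟩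
    (1ℤ + a * z) * w - (1ℤ + a * z) * (a ^ k * r)  ≡⟨ cong (_- (1ℤ + a * z) * (a ^ k * r)) eq ⟩
    1ℤ + a ^ k * r - (1ℤ + a * z) * (a ^ k * r)    ≡⟨ collect a z (a ^ k) r ⟩
    1ℤ + a * a ^ k * - (z * r)                     ∎)
    where
    distrib : ∀ c w v → c * (w - v) ≡ c * w - c * v
    distrib = ℤ-Solver.solve-∀
    collect : ∀ a z P r → 1ℤ + P * r - (1ℤ + a * z) * (P * r) ≡ 1ℤ + a * P * - (z * r)
    collect = ℤ-Solver.solve-∀

  geom-+ : ∀ U a b → geom U (a ℕ.+ b) ≡ geom U a + U ^ a * geom U b
  geom-+ U a zero = begin
    geom U (a ℕ.+ 0)        ≡⟨ cong (geom U) (ℕₚ.+-identityʳ a) ⟩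
    geom U a                ≡⟨ pad (geom U a) (U ^ a) ⟨
    geom U a + U ^ a * 0ℤ   ∎
    where
    pad : ∀ s v → s + v * 0ℤ ≡ s
    pad = ℤ-Solver.solve-∀
  geom-+ U a (suc b) = begin
    geom U (a ℕ.+ suc b)                              ≡⟨ cong (geom U) (ℕₚ.+-suc a b) ⟩
    geom U (a ℕ.+ b) + U ^ (a ℕ.+ b)                  ≡⟨ cong₂ _+_ (geom-+ U a b) (^-distribˡ-+-* U a b) ⟩
    geom U a + U ^ a * geom U b + U ^ a * U ^ b       ≡⟨ collect (geom U a) (U ^ a) (geom U b) (U ^ b) ⟩
    geom U a + U ^ a * (geom U b + U ^ b)             ∎
    where
    collect : ∀ s v t w → s + v * t + v * w ≡ s + v * (t + w)
    collect = ℤ-Solver.solve-∀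

module PowerCochains (m : ℕ) (U : ℤ) where
  open import Data.Integer using (0ℤ; 1ℤ; _+_; _-_; _*_; _^_)
  open import Data.Integer.Properties using (+-inverseʳ; *-zeroˡ; +-identityˡ; +-identityʳ)
  import Data.Integer.Properties as ℤₚ
  import Data.Integer.Tactic.RingSolver as ℤ-Solver
  open Congruence m
  open Powers
  open SetoidReasoning setoid

  δ : (ℕ → ℤ) → ℕ → ℕ → ℤ
  δ c a b = U ^ a * c b - c (a ℕ.+ b) + c a

  IsCocycle¹ : (ℕ → ℤ) → Set
  IsCocycle¹ φ = ∀ a b → φ (a ℕ.+ b) ≈ φ a + U ^ a * φ b

  IsCocycle² : (ℕ → ℕ → ℤ) → Set
  IsCocycle² F = ∀ a b c → U ^ a * F b c - F (a ℕ.+ b) c + F a (b ℕ.+ c) - F a b ≈ 0ℤ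

  -- For the cyclic group of order n generated by U, with norm geom U n = 1 + U + ⋯ + U^(n-1),
  -- these say Ĥ⁻¹ = ker N / (U − 1)M and Ĥ⁰ = M^U / N M vanish for M = ℤ/m.
  Ĥ⁻¹Vanishes : ℕ → Set
  Ĥ⁻¹Vanishes n = ∀ x → geom U n * x ≈ 0ℤ → ∃ λ a → x ≈ (U - 1ℤ) * a

  Ĥ⁰Vanishes : ℕ → Set
  Ĥ⁰Vanishes n = ∀ y → (U - 1ℤ) * y ≈ 0ℤ → ∃ λ x → geom U n * x ≈ y

  invariant-fixed : ∀ {y} → (U - 1ℤ) * y ≈ 0ℤ → ∀ i → U ^ i * y ≈ y
  invariant-fixed {y} invariant i = begin
    U ^ i * y                        ≡⟨ split (U ^ i) y ⟩
    y + (U ^ i - 1ℤ) * y             ≡⟨ cong (λ v → y + v * y) (geom-telescope U i) ⟨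
    y + (U - 1ℤ) * geom U i * y      ≡⟨ reassoc y (U - 1ℤ) (geom U i) ⟩
    y + geom U i * ((U - 1ℤ) * y)    ≈⟨ +-congˡ y (*-congˡ (geom U i) invariant) ⟩
    y + geom U i * 0ℤ                ≡⟨ drop y (geom U i) ⟩
    y                                ∎
    where
    split : ∀ v y → v * y ≡ y + (v - 1ℤ) * y
    split = ℤ-Solver.solve-∀
    reassoc : ∀ y u s → y + u * s * y ≡ y + s * (u * y)
    reassoc = ℤ-Solver.solve-∀
    drop : ∀ y s → y + s * 0ℤ ≡ y
    drop = ℤ-Solver.solve-∀

  module _ (φ : ℕ → ℤ) (φ-cocycle : IsCocycle¹ φ) where

    cocycle¹-zero : φ 0 ≈ 0ℤ
    cocycle¹-zero = begin
      φ 0                        ≡⟨ unit (φ 0) ⟩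
      φ 0 + 1ℤ * φ 0 - φ 0       ≈⟨ -congʳ (φ 0) (φ-cocycle 0 0) ⟨
      φ 0 - φ 0                  ≡⟨ +-inverseʳ (φ 0) ⟩
      0ℤ                         ∎
      where
      unit : ∀ x → x ≡ x + 1ℤ * x - x
      unit = ℤ-Solver.solve-∀

    cocycle¹-geom : ∀ i → φ i ≈ geom U i * φ 1
    cocycle¹-geom zero = begin
      φ 0             ≈⟨ cocycle¹-zero ⟩
      0ℤ              ≡⟨ *-zeroˡ (φ 1) ⟨
      0ℤ * φ 1        ∎
    cocycle¹-geom (suc i) = begin
      φ (suc i)                        ≡⟨ cong φ (ℕₚ.+-comm 1 i) ⟩
      φ (i ℕ.+ 1)                      ≈⟨ φ-cocycle i 1 ⟩
      φ i + U ^ i * φ 1                ≈⟨ +-congʳ (U ^ i * φ 1) (cocycle¹-geom i) ⟩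
      geom U i * φ 1 + U ^ i * φ 1     ≡⟨ ℤₚ.*-distribʳ-+ (φ 1) (geom U i) (U ^ i) ⟨
      (geom U i + U ^ i) * φ 1         ∎

  cocycle¹⇒coboundary : ∀ n → Ĥ⁻¹Vanishes n → ∀ φ → IsCocycle¹ φ → φ n ≈ φ 0 →
                        ∃ λ a → ∀ i → φ i ≈ U ^ i * a - a
  cocycle¹⇒coboundary n Ĥ⁻¹=0 φ φ-cocycle φ-periodic = a , coboundary
    where
    norm≈0 : geom U n * φ 1 ≈ 0ℤ
    norm≈0 = begin
      geom U n * φ 1   ≈⟨ cocycle¹-geom φ φ-cocycle n ⟨
      φ n              ≈⟨ φ-periodic ⟩
      φ 0              ≈⟨ cocycle¹-zero φ φ-cocycle ⟩
      0ℤ               ∎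
    a : ℤ
    a = proj₁ (Ĥ⁻¹=0 (φ 1) norm≈0)
    coboundary : ∀ i → φ i ≈ U ^ i * a - a
    coboundary i = begin
      φ i                          ≈⟨ cocycle¹-geom φ φ-cocycle i ⟩
      geom U i * φ 1               ≈⟨ *-congˡ (geom U i) (proj₂ (Ĥ⁻¹=0 (φ 1) norm≈0)) ⟩
      geom U i * ((U - 1ℤ) * a)    ≡⟨ swap (geom U i) (U - 1ℤ) a ⟩
      (U - 1ℤ) * geom U i * a      ≡⟨ cong (_* a) (geom-telescope U i) ⟩
      (U ^ i - 1ℤ) * a             ≡⟨ distrib (U ^ i) a ⟩
      U ^ i * a - a                ∎
      where
      swap : ∀ s u a → s * (u * a) ≡ u * s * a
      swap = ℤ-Solver.solve-∀
      distrib : ∀ v a → (v - 1ℤ) * a ≡ v * a - a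
      distrib = ℤ-Solver.solve-∀

  Φ : (ℕ → ℕ → ℤ) → ℕ → ℤ
  Φ F zero = 0ℤ
  Φ F (suc i) = Φ F i + F i 1

  c₀ : (ℕ → ℕ → ℤ) → ℕ → ℤ
  c₀ F i = F 0 0 - Φ F i

  δc₀-zero : ∀ F a → δ (c₀ F) a 0 ≡ U ^ a * F 0 0
  δc₀-zero F a =
    trans (cong (λ i → U ^ a * (F 0 0 - 0ℤ) - (F 0 0 - Φ F i) + (F 0 0 - Φ F a)) (ℕₚ.+-identityʳ a))
          (cancel (U ^ a) (F 0 0) (Φ F a))
    where
    cancel : ∀ v f s → v * (f - 0ℤ) - (f - s) + (f - s) ≡ v * f
    cancel = ℤ-Solver.solve-∀

  δc₀-suc : ∀ F a b → δ (c₀ F) a (suc b) ≡ δ (c₀ F) a b + F (a ℕ.+ b) 1 - U ^ a * F b 1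
  δc₀-suc F a b =
    trans (cong (λ i → U ^ a * (F 0 0 - Φ F (suc b)) - (F 0 0 - Φ F i) + (F 0 0 - Φ F a)) (ℕₚ.+-suc a b))
          (regroup (U ^ a) (F 0 0) (Φ F b) (F b 1) (Φ F (a ℕ.+ b)) (F (a ℕ.+ b) 1) (Φ F a))
    where
    regroup : ∀ v f s g t h r → v * (f - (s + g)) - (f - (t + h)) + (f - r) ≡ v * (f - s) - (f - t) + (f - r) + h - v * g
    regroup = ℤ-Solver.solve-∀

  cocycle²-free : ∀ F → IsCocycle² F → ∀ a b → F a b ≈ δ (c₀ F) a b
  cocycle²-free F F-cocycle a zero = begin
    F a 0                                                         ≡⟨ cong (λ i → F i 0) (ℕₚ.+-identityʳ a) ⟨
    F (a ℕ.+ 0) 0                                                 ≡⟨ isolate (U ^ a * F 0 0) (F (a ℕ.+ 0) 0) (F a 0) ⟩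
    U ^ a * F 0 0 - (U ^ a * F 0 0 - F (a ℕ.+ 0) 0 + F a 0 - F a 0) ≈⟨ -congˡ (U ^ a * F 0 0) (F-cocycle a 0 0) ⟩
    U ^ a * F 0 0 - 0ℤ                                            ≡⟨ +-identityʳ (U ^ a * F 0 0) ⟩
    U ^ a * F 0 0                                                 ≡⟨ δc₀-zero F a ⟨
    δ (c₀ F) a 0                                                  ∎
    where
    isolate : ∀ v x y → x ≡ v - (v - x + y - y)
    isolate = ℤ-Solver.solve-∀
  cocycle²-free F F-cocycle a (suc b) = begin
    F a (suc b)
      ≡⟨ cong (F a) (ℕₚ.+-comm 1 b) ⟩
    F a (b ℕ.+ 1)
      ≡⟨ split (U ^ a * F b 1) (F (a ℕ.+ b) 1) (F a (b ℕ.+ 1)) (F a b) ⟩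
    (U ^ a * F b 1 - F (a ℕ.+ b) 1 + F a (b ℕ.+ 1) - F a b) + (F a b + F (a ℕ.+ b) 1 - U ^ a * F b 1)
      ≈⟨ +-cong (F-cocycle a b 1) (-congʳ (U ^ a * F b 1) (+-congʳ (F (a ℕ.+ b) 1) (cocycle²-free F F-cocycle a b))) ⟩
    0ℤ + (δ (c₀ F) a b + F (a ℕ.+ b) 1 - U ^ a * F b 1)
      ≡⟨ +-identityˡ _ ⟩
    δ (c₀ F) a b + F (a ℕ.+ b) 1 - U ^ a * F b 1
      ≡⟨ δc₀-suc F a b ⟨
    δ (c₀ F) a (suc b) ∎
    where
    split : ∀ v h y x → y ≡ (v - h + y - x) + (x + h - v)
    split = ℤ-Solver.solve-∀

  δ-+geom : ∀ c x a b → δ (λ i → c i + geom U i * x) a b ≡ δ c a b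
  δ-+geom c x a b = trans (cong (λ g → U ^ a * (c b + geom U b * x) - (c (a ℕ.+ b) + g * x) + (c a + geom U a * x))
                                (geom-+ U a b))
                          (cancel (U ^ a) (c b) (geom U b) x (c (a ℕ.+ b)) (geom U a) (c a))
    where
    cancel : ∀ v d h x e g r → v * (d + h * x) - (e + (g + v * h) * x) + (r + g * x) ≡ v * d - e + r
    cancel = ℤ-Solver.solve-∀

  module _ (n : ℕ) (F : ℕ → ℕ → ℤ) (F-cocycle : IsCocycle² F)
           (periodicˡ : ∀ a b → F (a ℕ.+ n) b ≈ F a b) (periodicʳ : ∀ a b → F a (b ℕ.+ n) ≈ F a b) where

    Φ-shift : ∀ i → Φ F (i ℕ.+ n) ≈ Φ F i + Φ F n
    Φ-shift zero = ≈-reflexive (sym (+-identityˡ (Φ F n)))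
    Φ-shift (suc i) = begin
      Φ F (i ℕ.+ n) + F (i ℕ.+ n) 1      ≈⟨ +-cong (Φ-shift i) (periodicˡ i 1) ⟩
      Φ F i + Φ F n + F i 1              ≡⟨ swap (Φ F i) (Φ F n) (F i 1) ⟩
      Φ F i + F i 1 + Φ F n              ∎
      where
      swap : ∀ s t f → s + t + f ≡ s + f + t
      swap = ℤ-Solver.solve-∀

    Φ-invariant : (U - 1ℤ) * Φ F n ≈ 0ℤ
    Φ-invariant = begin
      (U - 1ℤ) * Φ F n
        ≡⟨ expand U (F 0 0) (Φ F n) (F n 1) (F 0 1) ⟩
      (δ (c₀ F) 1 0 - δ (c₀ F) 1 n) + (F n 1 - F 0 1)
        ≈⟨ +-cong (≈⇒-≈0 δ10≈δ1n) (≈⇒-≈0 (periodicˡ 0 1)) ⟩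
      0ℤ + 0ℤ
        ≡⟨⟩
      0ℤ ∎
      where
      δ10≈δ1n : δ (c₀ F) 1 0 ≈ δ (c₀ F) 1 n
      δ10≈δ1n = begin
        δ (c₀ F) 1 0   ≈⟨ cocycle²-free F F-cocycle 1 0 ⟨
        F 1 0          ≈⟨ periodicʳ 1 0 ⟨
        F 1 n          ≈⟨ cocycle²-free F F-cocycle 1 n ⟩
        δ (c₀ F) 1 n   ∎
      expand : ∀ U f s h g →
        (U - 1ℤ) * s ≡ (U * 1ℤ * (f - 0ℤ) - (f - (0ℤ + g)) + (f - (0ℤ + g))
                        - (U * 1ℤ * (f - s) - (f - (s + h)) + (f - (0ℤ + g)))) + (h - g)
      expand = ℤ-Solver.solve-∀

    -- c₀ F drifts by −Φ F n per period; a 1-cocycle i ↦ geom U i * x with norm Φ F n compensates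
    corrected-periodic : ∀ {x} → geom U n * x ≈ Φ F n → ∀ i →
                         c₀ F (i ℕ.+ n) + geom U (i ℕ.+ n) * x ≈ c₀ F i + geom U i * x
    corrected-periodic {x} norm≈Φ i = begin
      F 0 0 - Φ F (i ℕ.+ n) + geom U (i ℕ.+ n) * x
        ≈⟨ +-cong (-congˡ (F 0 0) (Φ-shift i)) (≈-reflexive (cong (_* x) (geom-+ U i n))) ⟩
      F 0 0 - (Φ F i + Φ F n) + (geom U i + U ^ i * geom U n) * x
        ≡⟨ regroup (F 0 0) (Φ F i) (Φ F n) (geom U i) (U ^ i) (geom U n) x ⟩
      c i + (U ^ i * (geom U n * x) - Φ F n)
        ≈⟨ +-congˡ (c i) (-congʳ (Φ F n) (*-congˡ (U ^ i) norm≈Φ)) ⟩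
      c i + (U ^ i * Φ F n - Φ F n)
        ≈⟨ +-congˡ (c i) (≈⇒-≈0 (invariant-fixed Φ-invariant i)) ⟩
      c i + 0ℤ
        ≡⟨ +-identityʳ (c i) ⟩
      c i ∎
      where
      c : ℕ → ℤ
      c i = c₀ F i + geom U i * x
      regroup : ∀ f s t g v h x → f - (s + t) + (g + v * h) * x ≡ f - s + g * x + (v * (h * x) - t)
      regroup = ℤ-Solver.solve-∀

  cocycle²⇒coboundary : ∀ n → Ĥ⁰Vanishes n → ∀ F → IsCocycle² F →
                        (∀ a b → F (a ℕ.+ n) b ≈ F a b) → (∀ a b → F a (b ℕ.+ n) ≈ F a b) →
                        ∃ λ c → (∀ i → c (i ℕ.+ n) ≈ c i) × (∀ a b → F a b ≈ δ c a b)
  cocycle²⇒coboundary n Ĥ⁰=0 F F-cocycle periodicˡ periodicʳ =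
    (λ i → c₀ F i + geom U i * x) ,
    corrected-periodic n F F-cocycle periodicˡ periodicʳ (proj₂ norm-preimage) ,
    λ a b → ≈-trans (cocycle²-free F F-cocycle a b) (≈-reflexive (sym (δ-+geom (c₀ F) x a b)))
    where
    norm-preimage : ∃ λ x → geom U n * x ≈ Φ F n
    norm-preimage = Ĥ⁰=0 (Φ F n) (Φ-invariant n F F-cocycle periodicˡ periodicʳ)
    x : ℤ
    x = proj₁ norm-preimage

module PrimePower (p : ℕ) (pp : Prime p) where
  open import Data.Nat using (zero; suc; _+_; _*_; _^_; _∸_; _<_; NonZero; s≤s)
  open import Data.Nat.Properties
  open import Data.Nat.Divisibility
  open import Data.Nat.Primality using (euclidsLemma; prime⇒nonZero; prime⇒nonTrivial)
  open import Data.Nat.DivMod using (_/_; m≡m%n+[m/n]*n)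
  open import Data.Nat.Tactic.RingSolver using (solve-∀)
  open import Data.Sum using (inj₁; inj₂)
  open import Data.Empty using (⊥-elim)
  open import Relation.Nullary using (¬_)
  open import Relation.Binary.PropositionalEquality using (refl; sym; trans; cong; subst)
  open Binomial

  instance
    p≢0 : NonZero p
    p≢0 = prime⇒nonZero pp

  p∣p^ : ∀ {s} → 1 ≤ s → p ∣ p ^ s
  p∣p^ {suc s} _ = m∣m*n (p ^ s)

  1<p : 1 < p
  1<p = Data.Nat.nonTrivial⇒n>1 p {{prime⇒nonTrivial pp}}

  1<p^ : ∀ {s} → 1 ≤ s → 1 < p ^ s
  1<p^ {s} 1≤s = <-≤-trans 1<p (subst (_≤ p ^ s) (*-identityʳ p) (^-monoʳ-≤ p 1≤s))

  p∤1+p* : ∀ x → ¬ p ∣ 1 + p * x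
  p∤1+p* x p∣1+px = <⇒≢ 1<p
                         (sym (∣1⇒≡1 (∣m+n∣m⇒∣n (subst (p ∣_) (+-comm 1 (p * x)) p∣1+px) (m∣m*n x))))

  p∤1+p^* : ∀ {s} x → 1 ≤ s → ¬ p ∣ 1 + p ^ s * x
  p∤1+p^* {suc s} x _ = subst (λ y → ¬ p ∣ 1 + y) (sym (*-assoc p (p ^ s) x)) (p∤1+p* (p ^ s * x))

  p^m∣ab⇒p^m∣b : ∀ m {a b} → ¬ p ∣ a → p ^ m ∣ a * b → p ^ m ∣ b
  p^m∣ab⇒p^m∣b zero {b = b} _ _ = 1∣ b
  p^m∣ab⇒p^m∣b (suc m) {a} {b} p∤a p^m+1∣ab with euclidsLemma a b pp (∣-trans (m∣m*n (p ^ m)) p^m+1∣ab)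
  ... | inj₁ p∣a = ⊥-elim (p∤a p∣a)
  ... | inj₂ (divides q refl) =
    subst (p ^ suc m ∣_) (*-comm p q) (*-monoʳ-∣ p (p^m∣ab⇒p^m∣b m p∤a (*-cancelˡ-∣ p p^m∣aq)))
    where
    p^m∣aq : p * p ^ m ∣ p * (a * q)
    p^m∣aq = subst (p * p ^ m ∣_) (reorder a q p) p^m+1∣ab
      where
      reorder : ∀ a q p → a * (q * p) ≡ p * (a * q)
      reorder = solve-∀

  p^-mono-∣ : ∀ {a b} → a ≤ b → p ^ a ∣ p ^ b
  p^-mono-∣ {a} {b} a≤b =
    subst (p ^ a ∣_) (trans (sym (^-distribˡ-+-* p a (b ∸ a))) (cong (p ^_) (m+[n∸m]≡n a≤b))) (m∣m*n (p ^ (b ∸ a)))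

  LiftingCondition : ℕ → Set
  LiftingCondition j = (1 ≤ j × p % 2 ≡ 1) ⊎ (p ≡ 2 × 2 ≤ j)

  lifting-mono : ∀ {i j} → i ≤ j → LiftingCondition i → LiftingCondition j
  lifting-mono i≤j (inj₁ (1≤i , p-odd)) = inj₁ (≤-trans 1≤i i≤j , p-odd)
  lifting-mono i≤j (inj₂ (p≡2 , 2≤i)) = inj₂ (p≡2 , ≤-trans 2≤i i≤j)

  -- The square term of (1 + a)^p carries the binomial coefficient triangle p = C(p,2), divisible by p
  -- for odd p; for p = 2 it is absorbed by j ≥ 2 instead.
  lte-step : ∀ {j} → LiftingCondition j →
             ∀ w → ∃ λ z → (1 + p ^ j * w) ^ p ≡ 1 + p ^ suc j * (w + p * z)
  lte-step {suc j} (inj₁ (_ , p-odd)) w =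
    q * P * w * w + P * P * w * w * w * y ,
    trans (binomial-cubic a p)
          (trans (cong (λ t → 1 + p * a + t * (a * a) + a * a * a * y) triangle-p) (regroup p q P w y))
    where
    P q a y : ℕ
    P = p ^ j
    q = p / 2
    a = p * P * w
    y = cubicRest a p
    p≡1+q*2 : p ≡ suc (q * 2)
    p≡1+q*2 = trans (m≡m%n+[m/n]*n p 2) (cong (_+ q * 2) p-odd)
    triangle-p : triangle p ≡ p * q
    triangle-p = trans (cong triangle p≡1+q*2) (trans (triangle-odd q) (cong (_* q) (sym p≡1+q*2)))
    regroup : ∀ p q P w y →
              1 + p * (p * P * w) + p * q * (p * P * w * (p * P * w)) + p * P * w * (p * P * w) * (p * P * w) * y
              ≡ 1 + p * (p * P) * (w + p * (q * P * w * w + P * P * w * w * w * y))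
    regroup = solve-∀
  lte-step {1} (inj₂ (_ , s≤s ()))
  lte-step {suc (suc j)} (inj₂ (refl , _)) w =
    P * w * w + 2 * 2 * P * P * w * w * w * y ,
    trans (binomial-cubic (2 * (2 * P) * w) 2) (regroup P w y)
    where
    P y : ℕ
    P = 2 ^ j
    y = cubicRest (2 * (2 * P) * w) 2
    regroup : ∀ P w y → 1 + 2 * (2 * (2 * P) * w) + triangle 2 * (2 * (2 * P) * w * (2 * (2 * P) * w))
                          + 2 * (2 * P) * w * (2 * (2 * P) * w) * (2 * (2 * P) * w) * y
                      ≡ 1 + 2 * (2 * (2 * P)) * (w + 2 * (P * w * w + 2 * 2 * P * P * w * w * w * y))
    regroup = solve-∀

module PrincipalUnit (p k ν : ℕ) (pp : Prime p) (1≤k : 1 ≤ k) (k≤ν : k ≤ ν)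
                     (lifting : PrimePower.LiftingCondition p pp k) where
  open import Data.Nat using (zero; suc; _+_; _*_; _^_; _∸_; _<_; NonZero)
  open import Data.Nat.Properties
  open import Data.Nat.Divisibility
  open import Data.Nat.Primality using (euclidsLemma)
  open import Data.Nat.DivMod using ([m+kn]%n≡m%n)
  open import Data.Nat.Tactic.RingSolver using (solve-∀)
  open import Data.Sum using (inj₁; inj₂)
  open import Data.Empty using (⊥-elim)
  open import Relation.Nullary using (¬_)
  open import Relation.Binary.PropositionalEquality using (sym; trans; cong; subst)
  open Binomial
  open Remainders
  open PrimePower p pp

  u : ℕ
  u = 1 + p ^ k

  n : ℕ
  n = p ^ (ν ∸ k)

  instance
    p^k≢0 : NonZero (p ^ k)
    p^k≢0 = m^n≢0 p k
    p^ν≢0 : NonZero (p ^ ν)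
    p^ν≢0 = m^n≢0 p ν
    n≢0 : NonZero n
    n≢0 = m^n≢0 p (ν ∸ k)

  p^k*n≡p^ν : p ^ k * n ≡ p ^ ν
  p^k*n≡p^ν = trans (sym (^-distribˡ-+-* p k (ν ∸ k))) (cong (p ^_) (m+[n∸m]≡n k≤ν))

  u^p^ : ∀ m → ∃ λ z → u ^ (p ^ m) ≡ 1 + p ^ (k + m) * (1 + p * z)
  u^p^ zero = 0 , trans (base (p ^ k) p) (cong (λ e → 1 + p ^ e * (1 + p * 0)) (sym (+-identityʳ k)))
    where
    base : ∀ P p → (1 + P) * 1 ≡ 1 + P * (1 + p * 0)
    base = solve-∀
  u^p^ (suc m) with u^p^ m
  ... | z , u^p^m≡ with lte-step (lifting-mono (m≤m+n k m) lifting) (1 + p * z)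
  ... | z′ , lifted = z + z′ , (begin
    u ^ (p * p ^ m)                          ≡⟨ cong (u ^_) (*-comm p (p ^ m)) ⟩
    u ^ (p ^ m * p)                          ≡⟨ ^-*-assoc u (p ^ m) p ⟨
    (u ^ (p ^ m)) ^ p                        ≡⟨ cong (_^ p) u^p^m≡ ⟩
    (1 + p ^ (k + m) * (1 + p * z)) ^ p      ≡⟨ lifted ⟩
    1 + p * p ^ (k + m) * ((1 + p * z) + p * z′) ≡⟨ regroup p (p ^ (k + m)) z z′ ⟩
    1 + p * p ^ (k + m) * (1 + p * (z + z′))  ≡⟨ cong (λ e → 1 + p ^ e * (1 + p * (z + z′))) (+-suc k m) ⟨
    1 + p ^ (k + suc m) * (1 + p * (z + z′))  ∎)
    where
    open ≡-Reasoning
    regroup : ∀ p P z z′ → 1 + p * P * ((1 + p * z) + p * z′) ≡ 1 + p * P * (1 + p * (z + z′))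
    regroup = solve-∀

  u^n : ∃ λ z → u ^ n ≡ 1 + p ^ ν * (1 + p * z)
  u^n = let z , u^n≡ = u^p^ (ν ∸ k) in
        z , trans u^n≡ (cong (λ e → 1 + p ^ e * (1 + p * z)) (m+[n∸m]≡n k≤ν))

  u^≡1+p^k* : ∀ d → ∃ λ t → u ^ d ≡ 1 + p ^ k * t
  u^≡1+p^k* d = let z , expanded = binomial-linear (p ^ k) 1 d in
                d * 1 + p ^ k * z , trans (cong (λ P → (1 + P) ^ d) (sym (*-identityʳ (p ^ k)))) expanded

  p∤u^ : ∀ i → ¬ p ∣ u ^ i
  p∤u^ i = let t , u^i≡ = u^≡1+p^k* i in subst (λ x → ¬ p ∣ x) (sym u^i≡) (p∤1+p^* t 1≤k)

  p^m∣order : ∀ m d q → u ^ d ≡ 1 + p ^ (k + m) * q → p ^ m ∣ d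
  p^m∣order zero d q _ = 1∣ d
  p^m∣order (suc m) d q u^d≡ = p∣r⇒ (p^m∣order m d (p * q) u^d≡′)
    where
    u^d≡′ : u ^ d ≡ 1 + p ^ (k + m) * (p * q)
    u^d≡′ = trans u^d≡ (cong (1 +_) (trans (cong (λ e → p ^ e * q) (+-suc k m)) (*-assoc-comm p (p ^ (k + m)) q)))
      where
      *-assoc-comm : ∀ p P q → p * P * q ≡ P * (p * q)
      *-assoc-comm = solve-∀
    p∣r⇒ : p ^ m ∣ d → p ^ suc m ∣ d
    p∣r⇒ (divides r d≡r*p^m) = subst (p ^ suc m ∣_) (sym d≡r*p^m) (*-monoˡ-∣ (p ^ m) p∣r)
      where
      P z z′ : ℕ
      P = p ^ (k + m)
      z = proj₁ (u^p^ m)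
      z′ = proj₁ (binomial-linear P (1 + p * z) r)
      expansions : 1 + P * (p * q) ≡ 1 + P * (r * (1 + p * z) + P * z′)
      expansions = begin
        1 + P * (p * q)                    ≡⟨ u^d≡′ ⟨
        u ^ d                              ≡⟨ cong (u ^_) (trans d≡r*p^m (*-comm r (p ^ m))) ⟩
        u ^ (p ^ m * r)                    ≡⟨ ^-*-assoc u (p ^ m) r ⟨
        (u ^ (p ^ m)) ^ r                  ≡⟨ cong (_^ r) (proj₂ (u^p^ m)) ⟩
        (1 + P * (1 + p * z)) ^ r          ≡⟨ proj₂ (binomial-linear P (1 + p * z) r) ⟩
        1 + P * (r * (1 + p * z) + P * z′) ∎
        where open ≡-Reasoning
      pq≡ : p * q ≡ r * (1 + p * z) + P * z′
      pq≡ = *-cancelˡ-≡ _ _ P {{m^n≢0 p (k + m)}} (+-cancelˡ-≡ 1 _ _ expansions)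
      p∣r[1+pz] : p ∣ r * (1 + p * z)
      p∣r[1+pz] = ∣m+n∣m⇒∣n (subst (p ∣_) (trans pq≡ (+-comm (r * (1 + p * z)) (P * z′))) (m∣m*n q))
                            (∣m⇒∣m*n z′ (p∣p^ {k + m} (≤-trans 1≤k (m≤m+n k m))))
      p∣r : p ∣ r
      p∣r with euclidsLemma r (1 + p * z) pp p∣r[1+pz]
      ... | inj₁ p∣r = p∣r
      ... | inj₂ p∣1+pz = ⊥-elim (p∤1+p* z p∣1+pz)

  u^-injective-≤ : ∀ {i j} → i ≤ j → j < n → u ^ i % p ^ ν ≡ u ^ j % p ^ ν → i ≡ j
  u^-injective-≤ {i} {j} i≤j j<n same = ≤-antisym i≤j (m∸n≡0⇒m≤n d≡0)
    where
    open ≡-Reasoning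
    d t : ℕ
    d = j ∸ i
    t = proj₁ (u^≡1+p^k* d)
    u^j≡ : u ^ j ≡ u ^ i + u ^ i * (p ^ k * t)
    u^j≡ = begin
      u ^ j                        ≡⟨ cong (u ^_) (m+[n∸m]≡n i≤j) ⟨
      u ^ (i + d)                  ≡⟨ ^-distribˡ-+-* u i d ⟩
      u ^ i * u ^ d                ≡⟨ cong (u ^ i *_) (proj₂ (u^≡1+p^k* d)) ⟩
      u ^ i * (1 + p ^ k * t)      ≡⟨ *-distribˡ-+ (u ^ i) 1 (p ^ k * t) ⟩
      u ^ i * 1 + u ^ i * (p ^ k * t) ≡⟨ cong (_+ u ^ i * (p ^ k * t)) (*-identityʳ (u ^ i)) ⟩
      u ^ i + u ^ i * (p ^ k * t)  ∎
    p^ν∣p^k*t : p ^ ν ∣ p ^ k * t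
    p^ν∣p^k*t = p^m∣ab⇒p^m∣b ν (p∤u^ i)
      ([m+n]%o≡m%o⇒o∣n (u ^ i) _ (p ^ ν) (trans (cong (_% p ^ ν) (sym u^j≡)) (sym same)))
    s : ℕ
    s = quotient p^ν∣p^k*t
    u^d≡ : u ^ d ≡ 1 + p ^ (k + (ν ∸ k)) * s
    u^d≡ = begin
      u ^ d                       ≡⟨ proj₂ (u^≡1+p^k* d) ⟩
      1 + p ^ k * t               ≡⟨ cong (1 +_) (_∣_.equality p^ν∣p^k*t) ⟩
      1 + s * p ^ ν               ≡⟨ cong (1 +_) (*-comm s (p ^ ν)) ⟩
      1 + p ^ ν * s               ≡⟨ cong (λ e → 1 + p ^ e * s) (m+[n∸m]≡n k≤ν) ⟨
      1 + p ^ (k + (ν ∸ k)) * s   ∎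
    d≡0 : d ≡ 0
    d≡0 = n∣m∧m<n⇒m≡0 (p^m∣order (ν ∸ k) d s u^d≡) (≤-<-trans (m∸n≤m j i) j<n)

  u^-injective : ∀ {i j} → i < n → j < n → u ^ i % p ^ ν ≡ u ^ j % p ^ ν → i ≡ j
  u^-injective {i} {j} i<n j<n same with ≤-total i j
  ... | inj₁ i≤j = u^-injective-≤ i≤j j<n same
  ... | inj₂ j≤i = sym (u^-injective-≤ j≤i i<n (sym same))

  u^-periodic : ∀ i → u ^ (i + n) % p ^ ν ≡ u ^ i % p ^ ν
  u^-periodic i = trans (cong (_% p ^ ν) u^[i+n]≡) ([m+kn]%n≡m%n (u ^ i) (u ^ i * (1 + p * z)) (p ^ ν))
    where
    z : ℕ
    z = proj₁ u^n
    u^[i+n]≡ : u ^ (i + n) ≡ u ^ i + u ^ i * (1 + p * z) * p ^ ν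
    u^[i+n]≡ = trans (^-distribˡ-+-* u i n) (trans (cong (u ^ i *_) (proj₂ u^n)) (expand (u ^ i) (p ^ ν) (1 + p * z)))
      where
      expand : ∀ a N c → a * (1 + N * c) ≡ a + a * c * N
      expand = solve-∀

  u^%p^k : ∀ i → u ^ i % p ^ k ≡ 1
  u^%p^k i = let t , u^i≡ = u^≡1+p^k* i in
    trans (cong (_% p ^ k) (trans u^i≡ (cong (1 +_) (*-comm (p ^ k) t)))) ([1+kn]%n≡1 t (p ^ k) (1<p^ 1≤k))

module PrincipalUnitTate (p k ν : ℕ) (pp : Prime p) (1≤k : 1 ≤ k) (k≤ν : k ≤ ν)
                         (lifting : PrimePower.LiftingCondition p pp k) where
  open import Data.Integer using (+_; 0ℤ; 1ℤ; _+_; _-_; _*_; _^_; ∣_∣)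
  import Data.Integer.Properties as ℤₚ
  import Data.Integer.Divisibility.Signed as Signed
  import Data.Nat.Divisibility as ℕ∣
  import Data.Integer.Tactic.RingSolver as ℤ-Solver
  open PrimePower p pp using (p∤1+p*; p^m∣ab⇒p^m∣b)
  open PrincipalUnit p k ν pp 1≤k k≤ν lifting using (u; n; u^n; p^k*n≡p^ν; p^k≢0; n≢0)
  open Congruence (p ℕ.^ ν)
  open Powers
  open PowerCochains (p ℕ.^ ν) (+ u)

  z : ℕ
  z = proj₁ u^n

  c : ℕ
  c = 1 ℕ.+ p ℕ.* z

  U-1≡p^k : + u - 1ℤ ≡ + (p ℕ.^ k)
  U-1≡p^k = trans (cong (_- 1ℤ) (ℤₚ.pos-+ 1 (p ℕ.^ k))) (cancel (+ (p ℕ.^ k)))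
    where
    cancel : ∀ x → 1ℤ + x - 1ℤ ≡ x
    cancel = ℤ-Solver.solve-∀

  norm≡n*c : geom (+ u) n ≡ + (n ℕ.* c)
  norm≡n*c = ℤₚ.*-cancelˡ-≡ (+ (p ℕ.^ k)) _ _ (begin
    + (p ℕ.^ k) * geom (+ u) n               ≡⟨ cong (_* geom (+ u) n) U-1≡p^k ⟨
    (+ u - 1ℤ) * geom (+ u) n                ≡⟨ geom-telescope (+ u) n ⟩
    (+ u) ^ n - 1ℤ                           ≡⟨ cong (_- 1ℤ) (pos-^ u n) ⟨
    + (u ℕ.^ n) - 1ℤ                         ≡⟨ cong (λ x → + x - 1ℤ) (proj₂ u^n) ⟩
    + (1 ℕ.+ p ℕ.^ ν ℕ.* c) - 1ℤ             ≡⟨ cong (_- 1ℤ) (ℤₚ.pos-+ 1 (p ℕ.^ ν ℕ.* c)) ⟩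
    1ℤ + + (p ℕ.^ ν ℕ.* c) - 1ℤ              ≡⟨ cancel (+ (p ℕ.^ ν ℕ.* c)) ⟩
    + (p ℕ.^ ν ℕ.* c)                        ≡⟨ cong (λ N → + (N ℕ.* c)) p^k*n≡p^ν ⟨
    + (p ℕ.^ k ℕ.* n ℕ.* c)                  ≡⟨ cong +_ (ℕₚ.*-assoc (p ℕ.^ k) n c) ⟩
    + (p ℕ.^ k ℕ.* (n ℕ.* c))                ≡⟨ ℤₚ.pos-* (p ℕ.^ k) (n ℕ.* c) ⟩
    + (p ℕ.^ k) * + (n ℕ.* c)                ∎)
    where
    open ≡-Reasoning
    cancel : ∀ x → 1ℤ + x - 1ℤ ≡ x
    cancel = ℤ-Solver.solve-∀

  c-invertible : ∃ λ w → ∃ λ r → + c * w ≡ 1ℤ + + (p ℕ.^ k) * r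
  c-invertible = let w , r , inverse = 1+az-invertible (+ p) (+ z) k in w , r , (begin
    + c * w                   ≡⟨ cong (_* w) (trans (ℤₚ.pos-+ 1 (p ℕ.* z)) (cong (λ t → 1ℤ + t) (ℤₚ.pos-* p z))) ⟩
    (1ℤ + + p * + z) * w      ≡⟨ inverse ⟩
    1ℤ + (+ p) ^ k * r        ≡⟨ cong (λ P → 1ℤ + P * r) (pos-^ p k) ⟨
    1ℤ + + (p ℕ.^ k) * r      ∎)
    where open ≡-Reasoning

  Ĥ⁻¹=0 : Ĥ⁻¹Vanishes n
  Ĥ⁻¹=0 x norm·x≈0 = a , ≈-reflexive x≡[U-1]a
    where
    n*p^k∣ : n ℕ.* p ℕ.^ k ℕ∣.∣ n ℕ.* (c ℕ.* ∣ x ∣)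
    n*p^k∣ = subst₂ ℕ∣._∣_ (trans (sym p^k*n≡p^ν) (ℕₚ.*-comm (p ℕ.^ k) n)) (begin
      ∣ geom (+ u) n * x ∣           ≡⟨ cong (λ g → ∣ g * x ∣) norm≡n*c ⟩
      ∣ + (n ℕ.* c) * x ∣            ≡⟨ ℤₚ.abs-* (+ (n ℕ.* c)) x ⟩
      n ℕ.* c ℕ.* ∣ x ∣              ≡⟨ ℕₚ.*-assoc n c ∣ x ∣ ⟩
      n ℕ.* (c ℕ.* ∣ x ∣)            ∎) (Signed.∣⇒∣ᵤ (≈0⇒∣ norm·x≈0))
      where open ≡-Reasoning
    p^k∣x : + (p ℕ.^ k) Signed.∣ x
    p^k∣x = Signed.∣ᵤ⇒∣ (p^m∣ab⇒p^m∣b k (p∤1+p* z) (ℕ∣.*-cancelˡ-∣ n n*p^k∣))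
    a : ℤ
    a = Signed.quotient p^k∣x
    x≡[U-1]a : x ≡ (+ u - 1ℤ) * a
    x≡[U-1]a = trans (Signed._∣_.equality p^k∣x)
                     (trans (ℤₚ.*-comm a (+ (p ℕ.^ k))) (cong (_* a) (sym U-1≡p^k)))

  Ĥ⁰=0 : Ĥ⁰Vanishes n
  Ĥ⁰=0 y invariant = y′ * w , (begin
    geom (+ u) n * (y′ * w)                    ≡⟨ cong (_* (y′ * w)) (trans norm≡n*c (ℤₚ.pos-* n c)) ⟩
    + n * + c * (y′ * w)                       ≡⟨ regroup (+ n) (+ c) y′ w ⟩
    y′ * + n * (+ c * w)                       ≡⟨ cong (λ v → y′ * + n * v) (proj₂ (proj₂ c-invertible)) ⟩
    y′ * + n * (1ℤ + + (p ℕ.^ k) * r)          ≡⟨ expand y′ (+ n) (+ (p ℕ.^ k)) r ⟩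
    y′ * + n + y′ * r * (+ (p ℕ.^ k) * + n)    ≡⟨ cong (λ N → y′ * + n + y′ * r * N) p^k*n≡p^ν′ ⟩
    y′ * + n + y′ * r * + (p ℕ.^ ν)            ≈⟨ +-congˡ (y′ * + n) (multiple≈0 (y′ * r)) ⟩
    y′ * + n + 0ℤ                              ≡⟨ ℤₚ.+-identityʳ (y′ * + n) ⟩
    y′ * + n                                   ≡⟨ Signed._∣_.equality n∣y ⟨
    y                                          ∎)
    where
    open SetoidReasoning setoid
    p^k*n∣ : p ℕ.^ k ℕ.* n ℕ∣.∣ p ℕ.^ k ℕ.* ∣ y ∣
    p^k*n∣ = subst₂ ℕ∣._∣_ (sym p^k*n≡p^ν) (ℤₚ.abs-* (+ (p ℕ.^ k)) y)
                    (Signed.∣⇒∣ᵤ (≈0⇒∣ (subst (λ d → d * y ≈ 0ℤ) U-1≡p^k invariant)))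
    n∣y : + n Signed.∣ y
    n∣y = Signed.∣ᵤ⇒∣ (ℕ∣.*-cancelˡ-∣ (p ℕ.^ k) p^k*n∣)
    y′ w r : ℤ
    y′ = Signed.quotient n∣y
    w = proj₁ c-invertible
    r = proj₁ (proj₂ c-invertible)
    p^k*n≡p^ν′ : + (p ℕ.^ k) * + n ≡ + (p ℕ.^ ν)
    p^k*n≡p^ν′ = trans (sym (ℤₚ.pos-* (p ℕ.^ k) n)) (cong +_ p^k*n≡p^ν)
    regroup : ∀ n c y w → n * c * (y * w) ≡ y * n * (c * w)
    regroup = ℤ-Solver.solve-∀
    expand : ∀ y n P r → y * n * (1ℤ + P * r) ≡ y * n + y * r * (P * n)
    expand = ℤ-Solver.solve-∀

module GeneratorOfΩ (p k ν : ℕ) (pp : Prime p) (1≤k : 1 ≤ k) (k≤ν : k ≤ ν)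
                    (lifting : PrimePower.LiftingCondition p pp k) where
  open import Data.Nat using (_+_; _*_; _^_; _<_)
  open import Data.Nat.Properties using (^-distribˡ-+-*; *-comm)
  open import Data.Nat.DivMod using (_mod_; m%n<n; %-distribˡ-*; m∣n⇒o%n%m≡o%m; m<n*o⇒m/o<n)
  open import Data.Fin using (Fin; toℕ; fromℕ<)
  open import Data.Fin.Properties using (toℕ-fromℕ<; toℕ-injective; toℕ<n)
  open import Relation.Binary.PropositionalEquality using (setoid)
  open ≡-Reasoning
  open PrimePower p pp using (p^-mono-∣; 1<p^)
  open PrincipalUnit p k ν pp 1≤k k≤ν lifting
  open Remainders

  pow : ℕ → Res p k ν pp
  pow i = (u ^ i) mod p ^ ν

  toℕ-pow : ∀ i → toℕ (pow i) ≡ u ^ i % p ^ ν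
  toℕ-pow i = toℕ-fromℕ< _

  _∙_ : Res p k ν pp → Res p k ν pp → Res p k ν pp
  _∙_ = _·_ p k ν pp

  pow-+ : ∀ a b → pow a ∙ pow b ≡ pow (a + b)
  pow-+ a b = toℕ-injective (begin
    toℕ (pow a ∙ pow b)                      ≡⟨ toℕ-fromℕ< _ ⟩
    toℕ (pow a) * toℕ (pow b) % p ^ ν        ≡⟨ cong₂ (λ x y → x * y % p ^ ν) (toℕ-pow a) (toℕ-pow b) ⟩
    u ^ a % p ^ ν * (u ^ b % p ^ ν) % p ^ ν  ≡⟨ %-distribˡ-* (u ^ a) (u ^ b) (p ^ ν) ⟨
    u ^ a * u ^ b % p ^ ν                    ≡⟨ cong (_% p ^ ν) (^-distribˡ-+-* u a b) ⟨
    u ^ (a + b) % p ^ ν                      ≡⟨ toℕ-pow (a + b) ⟨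
    toℕ (pow (a + b))                        ∎)

  pow-periodic : ∀ i → pow (i + n) ≡ pow i
  pow-periodic i = toℕ-injective (trans (toℕ-pow (i + n)) (trans (u^-periodic i) (sym (toℕ-pow i))))

  pow-injective : ∀ {i j} → i < n → j < n → pow i ≡ pow j → i ≡ j
  pow-injective {i} {j} i<n j<n powi≡powj =
    u^-injective i<n j<n (trans (sym (toℕ-pow i)) (trans (cong toℕ powi≡powj) (toℕ-pow j)))

  digit : ℕ → ℕ
  digit x = x / p ^ k

  InΩ⇒%≡1 : ∀ {g} → InΩ p k ν pp g → toℕ g % p ^ k ≡ 1
  InΩ⇒%≡1 (β , g≡) = trans (cong (_% p ^ k) g≡) ([1+kn]%n≡1 β (p ^ k) (1<p^ 1≤k))

  pow∈Ω : ∀ i → InΩ p k ν pp (pow i)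
  pow∈Ω i = digit (toℕ (pow i)) , m%n≡1⇒m≡1+[m/n]*n (toℕ (pow i)) (p ^ k) pow%p^k≡1
    where
    pow%p^k≡1 : toℕ (pow i) % p ^ k ≡ 1
    pow%p^k≡1 = trans (cong (_% p ^ k) (toℕ-pow i))
                      (trans (m∣n⇒o%n%m≡o%m (p ^ k) (p ^ ν) (u ^ i) (p^-mono-∣ k≤ν)) (u^%p^k i))

  toDigit : Res p k ν pp → Fin n
  toDigit g = fromℕ< (m<n*o⇒m/o<n (subst (toℕ g <_) (trans (sym p^k*n≡p^ν) (*-comm (p ^ k) n)) (toℕ<n g)))

  toDigit-injectiveΩ : ∀ {g h} → InΩ p k ν pp g → InΩ p k ν pp h → toDigit g ≡ toDigit h → g ≡ h
  toDigit-injectiveΩ {g} {h} g∈Ω h∈Ω same = toℕ-injective (begin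
    toℕ g                       ≡⟨ m%n≡1⇒m≡1+[m/n]*n (toℕ g) (p ^ k) (InΩ⇒%≡1 g∈Ω) ⟩
    1 + digit (toℕ g) * p ^ k   ≡⟨ cong (λ d → 1 + d * p ^ k) digits ⟩
    1 + digit (toℕ h) * p ^ k   ≡⟨ m%n≡1⇒m≡1+[m/n]*n (toℕ h) (p ^ k) (InΩ⇒%≡1 h∈Ω) ⟨
    toℕ h                       ∎)
    where
    digits : digit (toℕ g) ≡ digit (toℕ h)
    digits = trans (sym (toℕ-fromℕ< _)) (trans (cong toℕ same) (toℕ-fromℕ< _))

  powerDigit : Fin n → Fin n
  powerDigit i = toDigit (pow (toℕ i))

  powerDigit-injective : ∀ {i j} → powerDigit i ≡ powerDigit j → i ≡ j
  powerDigit-injective {i} {j} same =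
    toℕ-injective (pow-injective (toℕ<n i) (toℕ<n j) (toDigit-injectiveΩ (pow∈Ω (toℕ i)) (pow∈Ω (toℕ j)) same))

  -- The n distinct powers u^i (i < n) fill the n digits β of the elements 1 + β p^k of Ω, by
  -- pigeonhole. Off Ω, log returns an arbitrary index.
  log : Res p k ν pp → ℕ
  log g = toℕ (proj₁ (injective⇒surjective powerDigit powerDigit-injective (toDigit g)))

  pow-log : ∀ {g} → InΩ p k ν pp g → pow (log g) ≡ g
  pow-log {g} g∈Ω = toDigit-injectiveΩ (pow∈Ω (log g)) g∈Ω
                    (proj₂ (injective⇒surjective powerDigit powerDigit-injective (toDigit g)))

  open Periodic (setoid (Res p k ν pp)) n pow pow-periodic using (periodic-mod)

  log-pow : ∀ i → log (pow i) ≡ i % n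
  log-pow i = pow-injective (toℕ<n _) (m%n<n i n) (trans (pow-log (pow∈Ω i)) (sym (periodic-mod i)))

module Vanishing (p k ν : ℕ) (pp : Prime p) (1≤k : 1 ≤ k) (k≤ν : k ≤ ν)
                 (lifting : PrimePower.LiftingCondition p pp k) where
  open import Data.Integer using (+_; 0ℤ; _+_; _-_; _*_; _^_)
  open import Data.Fin using (toℕ)
  open PrincipalUnit p k ν pp 1≤k k≤ν lifting using (u; n; p^ν≢0; n≢0)
  open PrincipalUnitTate p k ν pp 1≤k k≤ν lifting using (Ĥ⁻¹=0; Ĥ⁰=0)
  open GeneratorOfΩ p k ν pp 1≤k k≤ν lifting
  open Congruence (p ℕ.^ ν)
  open Powers using (pos-^)
  open PowerCochains (p ℕ.^ ν) (+ u)
  open SetoidReasoning setoid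

  act-pow : ∀ i y → act p k ν pp (pow i) y ≈ (+ u) ^ i * y
  act-pow i y = *-cong (begin
    + toℕ (pow i)           ≡⟨ cong +_ (toℕ-pow i) ⟩
    + (u ℕ.^ i % p ℕ.^ ν) ≈⟨ %-≈ (u ℕ.^ i) ⟩
    + (u ℕ.^ i)           ≡⟨ pos-^ u i ⟩
    (+ u) ^ i             ∎) (≈-refl {y})

  pullback¹ : ∀ f → IsCocycle1 p k ν pp f → IsCocycle¹ (λ i → f (pow i))
  pullback¹ f f-cocycle a b = begin
    f (pow (a ℕ.+ b))                          ≡⟨ cong f (pow-+ a b) ⟨
    f (pow a ∙ pow b)                            ≈⟨ fromUnsigned (f-cocycle (pow a) (pow b) (pow∈Ω a) (pow∈Ω b)) ⟩
    f (pow a) + act p k ν pp (pow a) (f (pow b))   ≈⟨ +-congˡ (f (pow a)) (act-pow a (f (pow b))) ⟩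
    f (pow a) + (+ u) ^ a * f (pow b)            ∎

  pullback² : ∀ f → IsCocycle2 p k ν pp f → IsCocycle² (λ a b → f (pow a) (pow b))
  pullback² f f-cocycle a b c = begin
    (+ u) ^ a * F b c - F (a ℕ.+ b) c + F a (b ℕ.+ c) - F a b
      ≈⟨ -congʳ (F a b) (+-cong (-cong (≈-sym (act-pow a (F b c)))
                                       (≈-reflexive (cong (λ g → f g (pow c)) (sym (pow-+ a b)))))
                                (≈-reflexive (cong (f (pow a)) (sym (pow-+ b c))))) ⟩
    act p k ν pp (pow a) (F b c) - f (pow a ∙ pow b) (pow c) + f (pow a) (pow b ∙ pow c) - F a b
      ≈⟨ fromUnsigned (f-cocycle (pow a) (pow b) (pow c) (pow∈Ω a) (pow∈Ω b) (pow∈Ω c)) ⟩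
    0ℤ ∎
    where
    F : ℕ → ℕ → ℤ
    F a b = f (pow a) (pow b)

  H¹=0 : H1Vanishes p k ν pp
  H¹=0 f f-cocycle = a , λ g g∈Ω → toUnsigned (coboundary g g∈Ω)
    where
    φ : ℕ → ℤ
    φ i = f (pow i)
    ℕ-coboundary : ∃ λ a → ∀ i → φ i ≈ (+ u) ^ i * a - a
    ℕ-coboundary = cocycle¹⇒coboundary n Ĥ⁻¹=0 φ (pullback¹ f f-cocycle) (≈-reflexive (cong f (pow-periodic 0)))
    a : ℤ
    a = proj₁ ℕ-coboundary
    coboundary : ∀ g → InΩ p k ν pp g → f g ≈ act p k ν pp g a - a
    coboundary g g∈Ω = begin
      f g                                  ≡⟨ cong f (pow-log g∈Ω) ⟨
      φ (log g)                            ≈⟨ proj₂ ℕ-coboundary (log g) ⟩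
      (+ u) ^ log g * a - a                ≈⟨ -congʳ a (act-pow (log g) a) ⟨
      act p k ν pp (pow (log g)) a - a       ≡⟨ cong (λ h → act p k ν pp h a - a) (pow-log g∈Ω) ⟩
      act p k ν pp g a - a                 ∎

  H²=0 : H2Vanishes p k ν pp
  H²=0 f f-cocycle = (λ g → c (log g)) , λ g h g∈Ω h∈Ω → toUnsigned (coboundary g h g∈Ω h∈Ω)
    where
    F : ℕ → ℕ → ℤ
    F a b = f (pow a) (pow b)
    ℕ-coboundary : ∃ λ c → (∀ i → c (i ℕ.+ n) ≈ c i) × (∀ a b → F a b ≈ δ c a b)
    ℕ-coboundary = cocycle²⇒coboundary n Ĥ⁰=0 F (pullback² f f-cocycle)
                     (λ a b → ≈-reflexive (cong (λ g → f g (pow b)) (pow-periodic a)))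
                     (λ a b → ≈-reflexive (cong (f (pow a)) (pow-periodic b)))
    c : ℕ → ℤ
    c = proj₁ ℕ-coboundary
    open Periodic setoid n c (proj₁ (proj₂ ℕ-coboundary)) using (periodic-mod)
    c∘log∘pow : ∀ i → c (log (pow i)) ≈ c i
    c∘log∘pow i = ≈-trans (≈-reflexive (cong c (log-pow i))) (periodic-mod i)
    coboundary : ∀ g h → InΩ p k ν pp g → InΩ p k ν pp h →
                 f g h ≈ act p k ν pp g (c (log h)) - c (log (g ∙ h)) + c (log g)
    coboundary g h g∈Ω h∈Ω = begin
      f g h                                      ≡⟨ cong₂ f (pow-log g∈Ω) (pow-log h∈Ω) ⟨
      F i j                                      ≈⟨ proj₂ (proj₂ ℕ-coboundary) i j ⟩
      (+ u) ^ i * c j - c (i ℕ.+ j) + c i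
        ≈⟨ +-congʳ (c i) (-cong (≈-sym (act-pow i (c j))) (≈-sym (c∘log∘pow (i ℕ.+ j)))) ⟩
      act p k ν pp (pow i) (c j) - c (log (pow (i ℕ.+ j))) + c i
        ≡⟨ cong₂ (λ x y → act p k ν pp x (c j) - c (log y) + c i) (pow-log g∈Ω)
                 (trans (sym (pow-+ i j)) (cong₂ _∙_ (pow-log g∈Ω) (pow-log h∈Ω))) ⟩
      act p k ν pp g (c j) - c (log (g ∙ h)) + c i ∎
      where
      i j : ℕ
      i = log g
      j = log h

lemma2p4 : (p k ν : ℕ) (pp : Prime p) → 1 ≤ k → k ≤ ν →
    (p % 2 ≡ 1 ⊎ (p ≡ 2 × 2 ≤ k)) →
    H1Vanishes p k ν pp × H2Vanishes p k ν pp
lemma2p4 p k ν pp 1≤k k≤ν p-odd-or-2≤k = H¹=0 , H²=0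
  where
  lifting : PrimePower.LiftingCondition p pp k
  lifting = Data.Sum.map₁ (1≤k ,_) p-odd-or-2≤k
  open Vanishing p k ν pp 1≤k k≤ν lifting
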